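{- For every nonnegative integer $k$ there is a finite set $Z$ of finite bipartite graphs such that for every finite bipartite graph $G$ with all vertex degrees at most $k$, there is a graph $H$ which is a disjoint union of finitely many graphs from $Z$ (repetitions allowed) and which has the same degree sequence as $G$.
   Context: Graphs are finite and simple. The degree sequence of a graph $G$ is the list of the degrees of all vertices of $G$ in decreasing order (including vertices of degree $0$). -}

module Defs where

open import Data.Nat using (ℕ; zero; suc; _+_; _≤_)
open import Data.Nat.Properties using (≤-decTotalOrder)
open import Data.Bool using (Bool; true; false)
open import Data.Fin using (Fin; splitAt)
open import Data.Sum using (_⊎_; inj₁; inj₂)
open import Data.List using (List; []; _∷_; length; filterᵇ; allFin; map)
open import Relation.Binary.PropositionalEquality using (_≡_; _≢_; refl)
open import Relation.Binary.Properties.DecTotalOrder ≤-decTotalOrder using (≥-decTotalOrder)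
import Data.List.Sort

record Graph : Set where
  field
    n     : ℕ
    adj   : Fin n → Fin n → Bool
    sym   : ∀ i j → adj i j ≡ adj j i
    loopless : ∀ i → adj i i ≡ false
open Graph public

degree : (G : Graph) → Fin (n G) → ℕ
degree G i = length (filterᵇ (adj G i) (allFin (n G)))

MaxDegree≤ : Graph → ℕ → Set
MaxDegree≤ G k = ∀ i → degree G i ≤ k

Bipartite : Graph → Set
Bipartite G = Σc
  where
  open import Data.Product using (Σ)
  Σc : Set
  Σc = Σ (Fin (n G) → Bool) λ c → ∀ i j → adj G i j ≡ true → c i ≢ c j

open Data.List.Sort ≥-decTotalOrder using (sort)

degreeSequence : Graph → List ℕ
degreeSequence G = sort (map (degree G) (allFin (n G)))

private
  adj⊕ : ∀ {m k} → (Fin m → Fin m → Bool) → (Fin k → Fin k → Bool)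
       → Fin (m + k) → Fin (m + k) → Bool
  adj⊕ {m} a b i j with splitAt m i | splitAt m j
  ... | inj₁ x | inj₁ y = a x y
  ... | inj₂ x | inj₂ y = b x y
  ... | inj₁ _ | inj₂ _ = false
  ... | inj₂ _ | inj₁ _ = false

  sym⊕ : ∀ {m k} (a : Fin m → Fin m → Bool) (b : Fin k → Fin k → Bool)
       → (∀ i j → a i j ≡ a j i) → (∀ i j → b i j ≡ b j i)
       → ∀ i j → adj⊕ a b i j ≡ adj⊕ a b j i
  sym⊕ {m} a b sa sb i j with splitAt m i | splitAt m j
  ... | inj₁ x | inj₁ y = sa x y
  ... | inj₂ x | inj₂ y = sb x y
  ... | inj₁ _ | inj₂ _ = refl
  ... | inj₂ _ | inj₁ _ = refl

  loop⊕ : ∀ {m k} (a : Fin m → Fin m → Bool) (b : Fin k → Fin k → Bool)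
        → (∀ i → a i i ≡ false) → (∀ i → b i i ≡ false)
        → ∀ i → adj⊕ a b i i ≡ false
  loop⊕ {m} a b la lb i with splitAt m i
  ... | inj₁ x = la x
  ... | inj₂ x = lb x

_⊕_ : Graph → Graph → Graph
G ⊕ H = record
  { n = n G + n H
  ; adj = adj⊕ (adj G) (adj H)
  ; sym = sym⊕ (adj G) (adj H) (sym G) (sym H)
  ; loopless = loop⊕ (adj G) (adj H) (loopless G) (loopless H)
  }

emptyGraph : Graph
emptyGraph = record { n = 0 ; adj = λ () ; sym = λ () ; loopless = λ () }

disjointUnion : List Graph → Graph
disjointUnion [] = emptyGraph
disjointUnion (G ∷ Gs) = G ⊕ disjointUnion Gs

-- A pair of degree lists X, Y with entries at most k and Σ X = Σ Y ≥ (k+1)² is realised by a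
-- simple bipartite graph: deal Σ X stubs to the vertices of X in consecutive runs, likewise for Y,
-- and join stub t of X to stub π t of Y, where π reads a grid with k + 1 columns column by column.
-- Stubs of one vertex are fewer than k apart and π moves such stubs at least k apart, so no edge is
-- doubled. In a bipartite G of maximum degree k the positive degrees of the two colour classes have
-- equal sums (handshake). By pigeonhole both lists contain some d resp. e at least k(k+1)² times as
-- long as both are long, so blocks of e(k+1)² copies of d against d(k+1)² copies of e can be cut off
-- until one list is short, and what is left is one more block of bounded size. If instead the sums are
-- below (k+1)², the non-isolated part of G is itself small. Isolated vertices are single-vertex graphs.
-- Hence Z can be taken to be all bipartite graphs on boundedly many vertices.

module Submission where

open import Defs hiding (sym)
open import Level using (Level)
open import Function using (_∘_; id; _⇔_; mk⇔; Injective; Equivalence)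
open import Data.Empty using (⊥; ⊥-elim)
open import Data.Unit using (tt)
open import Data.Product using (Σ; ∃; _×_; _,_; proj₁; proj₂)
open import Data.Sum using (_⊎_; inj₁; inj₂)
open import Data.Bool using (Bool; true; false; not; _∧_; _xor_; if_then_else_; T)
open import Data.Bool.Properties using (∧-comm; ∧-zeroʳ; xor-comm; xor-same; not-involutive; T-≡; T-∧)
open import Data.Bool.ListAction using (any; or)
open import Data.Nat
  using (ℕ; zero; suc; >-nonZero; s≤s⁻¹; _+_; _*_; _∸_; _⊓_; _≤_; _<_; _≤?_; _<?_; _≡ᵇ_; _<ᵇ_; z≤n; s≤s)
open import Data.Nat.Properties
open import Data.Nat.DivMod using (_/_; _%_; m≡m%n+[m/n]*n; m%n<n; m*n/n≡m; /-monoˡ-≤)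
open import Data.Nat.ListAction using (sum)
open import Data.Nat.ListAction.Properties using (sum-++; sum-↭)
open import Data.Nat.Induction using (<-wellFounded)
open import Induction.WellFounded using (Acc; acc)
open import Data.Fin as Fin using (Fin; toℕ; _↑ˡ_; _↑ʳ_; splitAt)
open import Data.Vec.Functional using () renaming (_∷_ to _∷ᶠ_)
open import Data.Fin.Properties
  using (splitAt-↑ˡ; splitAt-↑ʳ; toℕ<n; toℕ-fromℕ<; toℕ-injective; punchOut-injective; injective⇒≤)
import Data.Fin.Properties as Finₚ
open import Data.List using (List; []; _∷_; length; map; _++_; filterᵇ; allFin; tabulate; lookup;
  upTo; applyUpTo; concatMap; replicate)
open import Data.List.Properties using (filter-++; length-++; map-tabulate; map-upTo; map-++; map-cong;
  map-cong-local; map-∘; tabulate-cong; tabulate-lookup; length-map; length-replicate; length-upTo;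
  length-applyUpTo; filter-some; ++-identityʳ; concatMap-++)
open import Data.List.Relation.Unary.All as All using (All; []; _∷_)
open import Data.List.Relation.Unary.All.Properties as All using (all-filter; ¬Any⇒All¬)
open import Data.List.Relation.Unary.Any as Any using (Any; here; there; any?)
open import Data.List.Relation.Unary.Any.Properties using (any⁺; any⁻)
open import Data.List.Membership.Propositional using (_∈_; find; lose)
open import Data.List.Membership.Propositional.Properties
  using (∈-allFin; ∈-map⁺; ∈-map⁻; ∈-filter⁺; ∈-filter⁻; ∈-upTo⁺; ∈-upTo⁻; ∈-applyUpTo⁺; ∈-applyUpTo⁻;
         ∈-concatMap⁺)
open import Data.List.Membership.Propositional.Properties.WithK using (unique∧set⇒bag)
open import Data.List.Relation.Binary.BagAndSetEquality using (∼bag⇒↭)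
open import Data.List.Relation.Unary.Unique.Propositional using (Unique)
open import Data.List.Relation.Unary.AllPairs using ([]; _∷_)
open import Data.List.Relation.Unary.Unique.Propositional.Properties using (upTo⁺)
import Data.List.Relation.Unary.Unique.Propositional.Properties as Unique
open import Data.List.Relation.Binary.Permutation.Propositional
  using (_↭_; ↭-refl; ↭-reflexive; ↭-sym; ↭-trans; prep; ↭⇒↭ₛ)
open import Data.List.Relation.Binary.Permutation.Propositional.Properties
  using (shift; ↭-length; filter-↭; map⁺; ++⁺; ++⁺ˡ; All-resp-↭; ++-commutativeMonoid)
open import Relation.Nullary using (yes; no; contradiction)
open import Relation.Nullary.Decidable using (T?)
open import Relation.Binary.PropositionalEquality
open import Relation.Binary.Bundles using (DecTotalOrder)
open import Relation.Binary.Definitions using (tri<; tri≈; tri>)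
open import Relation.Binary.Properties.DecTotalOrder ≤-decTotalOrder using (≥-decTotalOrder)
open import Data.List.Sort ≥-decTotalOrder using (sort; sort-↭; sort-↗)
open import Data.List.Relation.Unary.Sorted.TotalOrder.Properties using (↗↭↗⇒≋)
open import Data.List.Relation.Binary.Pointwise using (Pointwise-≡⇒≡)
open import Algebra.Bundles using (CommutativeMonoid)
open import Algebra.Properties.CommutativeSemigroup +-commutativeSemigroup using (interchange)
open import Algebra.Properties.CommutativeSemigroup
  (CommutativeMonoid.commutativeSemigroup (++-commutativeMonoid {A = ℕ}))
  using () renaming (interchange to ++-interchange)

private
  variable
    a : Level
    A B : Set a


-- Counting

count : (A → Bool) → List A → ℕ
count p xs = length (filterᵇ p xs)

count-∷ : ∀ (p : A → Bool) x xs → count p (x ∷ xs) ≡ (if p x then 1 else 0) + count p xs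
count-∷ p x xs with p x
... | true  = refl
... | false = refl

count-++ : ∀ (p : A → Bool) xs ys → count p (xs ++ ys) ≡ count p xs + count p ys
count-++ p xs ys = trans (cong length (filter-++ (T? ∘ p) xs ys)) (length-++ (filterᵇ p xs))

count-map : ∀ (p : B → Bool) (f : A → B) xs → count p (map f xs) ≡ count (p ∘ f) xs
count-map p f []       = refl
count-map p f (x ∷ xs) with p (f x)
... | true  = cong suc (count-map p f xs)
... | false = count-map p f xs

count-cong : ∀ {p q : A → Bool} xs → (∀ {x} → x ∈ xs → p x ≡ q x) → count p xs ≡ count q xs
count-cong []       p≗q = refl
count-cong {p = p} {q} (x ∷ xs) p≗q = begin
  count p (x ∷ xs)                    ≡⟨ count-∷ p x xs ⟩
  (if p x then 1 else 0) + count p xs ≡⟨ cong₂ (λ b n → (if b then 1 else 0) + n)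
                                               (p≗q (here refl)) (count-cong xs (p≗q ∘ there)) ⟩
  (if q x then 1 else 0) + count q xs ≡⟨ count-∷ q x xs ⟨
  count q (x ∷ xs)                    ∎
  where open ≡-Reasoning

count-true : ∀ (xs : List A) → count (λ _ → true) xs ≡ length xs
count-true []       = refl
count-true (x ∷ xs) = cong suc (count-true xs)

count-false : ∀ (xs : List A) → count (λ _ → false) xs ≡ 0
count-false []       = refl
count-false (x ∷ xs) = count-false xs

count-filter-redundant : ∀ (p q : A → Bool) xs → (∀ {x} → T (p x) → T (q x)) →
                         count p (filterᵇ q xs) ≡ count p xs
count-filter-redundant p q []       p⇒q = refl
count-filter-redundant p q (x ∷ xs) p⇒q with q x in qx
... | true = trans (count-∷ p x (filterᵇ q xs))
                   (trans (cong ((if p x then 1 else 0) +_) (count-filter-redundant p q xs p⇒q))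
                          (sym (count-∷ p x xs)))
... | false with p x in px
...   | false = count-filter-redundant p q xs p⇒q
...   | true  = ⊥-elim (subst T qx (p⇒q (subst T (sym px) tt)))

sum-map-+ : ∀ (f g : A → ℕ) xs → sum (map (λ x → f x + g x) xs) ≡ sum (map f xs) + sum (map g xs)
sum-map-+ f g []       = refl
sum-map-+ f g (x ∷ xs) =
  trans (cong (f x + g x +_) (sum-map-+ f g xs)) (interchange (f x) (g x) _ _)

sum-map-0 : ∀ (xs : List A) → sum (map (λ _ → 0) xs) ≡ 0
sum-map-0 []       = refl
sum-map-0 (x ∷ xs) = sum-map-0 xs

count≡sum-indicators : ∀ (p : A → Bool) xs → count p xs ≡ sum (map (λ x → if p x then 1 else 0) xs)
count≡sum-indicators p []       = refl
count≡sum-indicators p (x ∷ xs) = trans (count-∷ p x xs) (cong (_ +_) (count≡sum-indicators p xs))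

sum-count-swap : ∀ (R : A → B → Bool) xs ys →
  sum (map (λ x → count (R x) ys) xs) ≡ sum (map (λ y → count (λ x → R x y) xs) ys)
sum-count-swap R []       ys = sym (sum-map-0 ys)
sum-count-swap R (x ∷ xs) ys = begin
  count (R x) ys + sum (map (λ x → count (R x) ys) xs)
    ≡⟨ cong₂ _+_ (count≡sum-indicators (R x) ys) (sum-count-swap R xs ys) ⟩
  sum (map (λ y → if R x y then 1 else 0) ys) + sum (map (λ y → count (λ x → R x y) xs) ys)
    ≡⟨ sum-map-+ _ _ ys ⟨
  sum (map (λ y → (if R x y then 1 else 0) + count (λ x → R x y) xs) ys)
    ≡⟨ cong sum (map-cong (λ y → count-∷ (λ x → R x y) x xs) ys) ⟨
  sum (map (λ y → count (λ x → R x y) (x ∷ xs)) ys) ∎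
  where open ≡-Reasoning

filter-partition-↭ : ∀ (p : A → Bool) xs → xs ↭ filterᵇ p xs ++ filterᵇ (not ∘ p) xs
filter-partition-↭ p []       = ↭-refl
filter-partition-↭ p (x ∷ xs) with p x
... | true  = prep x (filter-partition-↭ p xs)
... | false = ↭-trans (prep x (filter-partition-↭ p xs)) (↭-sym (shift x (filterᵇ p xs) _))

map-filterᵇ : ∀ (p : B → Bool) (f : A → B) xs → map f (filterᵇ (p ∘ f) xs) ≡ filterᵇ p (map f xs)
map-filterᵇ p f []       = refl
map-filterᵇ p f (x ∷ xs) with p (f x)
... | true  = cong (f x ∷_) (map-filterᵇ p f xs)
... | false = map-filterᵇ p f xs

applyUpTo-+ : ∀ (f : ℕ → A) m n → applyUpTo f (m + n) ≡ applyUpTo f m ++ applyUpTo (f ∘ (m +_)) n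
applyUpTo-+ f zero    n = refl
applyUpTo-+ f (suc m) n = cong (f 0 ∷_) (applyUpTo-+ (f ∘ suc) m n)

upTo-+ : ∀ m n → upTo (m + n) ≡ upTo m ++ map (m +_) (upTo n)
upTo-+ m n = trans (applyUpTo-+ id m n) (cong (upTo m ++_) (sym (map-upTo (m +_) n)))

tabulate-toℕ : ∀ n (f : ℕ → A) → tabulate {n = n} (f ∘ toℕ) ≡ applyUpTo f n
tabulate-toℕ zero    f = refl
tabulate-toℕ (suc n) f = cong (f 0 ∷_) (tabulate-toℕ n (f ∘ suc))

tabulate-+ : ∀ m n (f : Fin (m + n) → A) → tabulate f ≡ tabulate (f ∘ (_↑ˡ n)) ++ tabulate (f ∘ (m ↑ʳ_))
tabulate-+ zero    n f = refl
tabulate-+ (suc m) n f = cong (f Fin.zero ∷_) (tabulate-+ m n (f ∘ Fin.suc))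

count-tabulate : ∀ {n} (p : A → Bool) (f : Fin n → A) → count p (tabulate f) ≡ count (p ∘ f) (allFin n)
count-tabulate p f = trans (cong (count p) (sym (map-tabulate id f))) (count-map p f (allFin _))

unique-map-on : ∀ (f : A → B) {xs} → Unique xs → (∀ {x y} → x ∈ xs → y ∈ xs → f x ≡ f y → x ≡ y) →
                Unique (map f xs)
unique-map-on f []            inj = []
unique-map-on f (x∉xs ∷ xs!) inj =
  All.map⁺ (All.tabulate λ y∈xs fx≡fy → All.lookup x∉xs y∈xs (inj (here refl) (there y∈xs) fx≡fy))
  ∷ unique-map-on f xs! (λ x∈ y∈ → inj (there x∈) (there y∈))

unique-⇔-length : ∀ {xs ys : List A} → Unique xs → Unique ys → (∀ {z} → z ∈ xs ⇔ z ∈ ys) →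
                  length xs ≡ length ys
unique-⇔-length xs! ys! xs⇔ys = ↭-length (∼bag⇒↭ (unique∧set⇒bag xs! ys! xs⇔ys))

injective⇒surjective : ∀ {n} {f : Fin n → Fin n} → Injective _≡_ _≡_ f → ∀ y → ∃ λ x → f x ≡ y
injective⇒surjective {suc n} {f} f-inj y with Finₚ.any? (λ x → f x Finₚ.≟ y)
... | yes hit = hit
... | no miss = contradiction (injective⇒≤ punched-inj) (<-irrefl refl)
  where
  punched : Fin (suc n) → Fin n
  punched x = Fin.punchOut {i = y} {j = f x} (λ y≡fx → miss (x , sym y≡fx))

  punched-inj : Injective _≡_ _≡_ punched
  punched-inj {x} {x′} eq =
    f-inj (punchOut-injective (λ y≡fx → miss (x , sym y≡fx)) (λ y≡fx′ → miss (x′ , sym y≡fx′)) eq)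

module _ {m : ℕ} {g : ℕ → ℕ} (g< : ∀ {t} → t < m → g t < m)
         (g-inj : ∀ {t u} → t < m → u < m → g t ≡ g u → t ≡ u) where

  surjective-below : ∀ {s} → s < m → ∃ λ t → t < m × g t ≡ s
  surjective-below {s} s<m =
    let (x , fx≡s) = injective⇒surjective f-inj (Fin.fromℕ< s<m)
    in toℕ x , toℕ<n x , trans (sym (toℕ-fromℕ< _)) (trans (cong toℕ fx≡s) (toℕ-fromℕ< s<m))
    where
    f : Fin m → Fin m
    f i = Fin.fromℕ< (g< (toℕ<n i))

    f-inj : Injective _≡_ _≡_ f
    f-inj {i} {j} eq = toℕ-injective (g-inj (toℕ<n i) (toℕ<n j)
      (trans (sym (toℕ-fromℕ< _)) (trans (cong toℕ eq) (toℕ-fromℕ< _))))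

  map-upTo-↭ : map g (upTo m) ↭ upTo m
  map-upTo-↭ = ∼bag⇒↭ (unique∧set⇒bag
    (unique-map-on g (upTo⁺ m) (λ t∈ u∈ → g-inj (∈-upTo⁻ t∈) (∈-upTo⁻ u∈))) (upTo⁺ m) (mk⇔ into onto))
    where
    into : ∀ {s} → s ∈ map g (upTo m) → s ∈ upTo m
    into s∈ = let (t , t∈ , s≡gt) = ∈-map⁻ g s∈ in
      subst (_∈ upTo m) (sym s≡gt) (∈-upTo⁺ (g< (∈-upTo⁻ t∈)))

    onto : ∀ {s} → s ∈ upTo m → s ∈ map g (upTo m)
    onto s∈ = let (t , t<m , gt≡s) = surjective-below (∈-upTo⁻ s∈) in
      subst (_∈ map g (upTo m)) gt≡s (∈-map⁺ g (∈-upTo⁺ t<m))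

  count-∘-upTo : ∀ (p : ℕ → Bool) → count (p ∘ g) (upTo m) ≡ count p (upTo m)
  count-∘-upTo p = trans (sym (count-map p g (upTo m))) (↭-length (filter-↭ (T? ∘ p) map-upTo-↭))

-- Degree lists

degrees : Graph → List ℕ
degrees G = map (degree G) (allFin (n G))

sort-cong : ∀ {xs ys : List ℕ} → xs ↭ ys → sort xs ≡ sort ys
sort-cong {xs} {ys} xs↭ys = Pointwise-≡⇒≡
  (↗↭↗⇒≋ (DecTotalOrder.totalOrder ≥-decTotalOrder) (sort-↗ xs) (sort-↗ ys)
         (↭⇒↭ₛ (↭-trans (sort-↭ xs) (↭-trans xs↭ys (↭-sym (sort-↭ ys))))))

count-allFin-+ : ∀ {m n} (p : Fin (m + n) → Bool) →
  count p (allFin (m + n)) ≡ count (p ∘ (_↑ˡ n)) (allFin m) + count (p ∘ (m ↑ʳ_)) (allFin n)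
count-allFin-+ {m} {n} p = begin
  count p (tabulate id)
    ≡⟨ cong (count p) (tabulate-+ m n id) ⟩
  count p (tabulate (_↑ˡ n) ++ tabulate (m ↑ʳ_))
    ≡⟨ count-++ p (tabulate (_↑ˡ n)) (tabulate (m ↑ʳ_)) ⟩
  count p (tabulate (_↑ˡ n)) + count p (tabulate (m ↑ʳ_))
    ≡⟨ cong₂ _+_ (count-tabulate p (_↑ˡ n)) (count-tabulate p (m ↑ʳ_)) ⟩
  count (p ∘ (_↑ˡ n)) (allFin m) + count (p ∘ (m ↑ʳ_)) (allFin n) ∎
  where open ≡-Reasoning

map-allFin-+ : ∀ {m n} (f : Fin (m + n) → A) →
  map f (allFin (m + n)) ≡ tabulate (f ∘ (_↑ˡ n)) ++ tabulate (f ∘ (m ↑ʳ_))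
map-allFin-+ {m = m} {n} f = trans (map-tabulate id f) (tabulate-+ m n f)

module _ (G H : Graph) where
  private
    g = n G
    h = n H
  open ≡-Reasoning

  adj-⊕-↑ˡ-↑ˡ : ∀ i j → adj (G ⊕ H) (i ↑ˡ h) (j ↑ˡ h) ≡ adj G i j
  adj-⊕-↑ˡ-↑ˡ i j rewrite splitAt-↑ˡ g i h | splitAt-↑ˡ g j h = refl

  adj-⊕-↑ˡ-↑ʳ : ∀ i j → adj (G ⊕ H) (i ↑ˡ h) (g ↑ʳ j) ≡ false
  adj-⊕-↑ˡ-↑ʳ i j rewrite splitAt-↑ˡ g i h | splitAt-↑ʳ g h j = refl

  adj-⊕-↑ʳ-↑ˡ : ∀ i j → adj (G ⊕ H) (g ↑ʳ i) (j ↑ˡ h) ≡ false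
  adj-⊕-↑ʳ-↑ˡ i j rewrite splitAt-↑ʳ g h i | splitAt-↑ˡ g j h = refl

  adj-⊕-↑ʳ-↑ʳ : ∀ i j → adj (G ⊕ H) (g ↑ʳ i) (g ↑ʳ j) ≡ adj H i j
  adj-⊕-↑ʳ-↑ʳ i j rewrite splitAt-↑ʳ g h i | splitAt-↑ʳ g h j = refl

  degree-⊕-↑ˡ : ∀ i → degree (G ⊕ H) (i ↑ˡ h) ≡ degree G i
  degree-⊕-↑ˡ i = begin
    degree (G ⊕ H) (i ↑ˡ h)
      ≡⟨ count-allFin-+ {g} {h} (adj (G ⊕ H) (i ↑ˡ h)) ⟩
    count (λ j → adj (G ⊕ H) (i ↑ˡ h) (j ↑ˡ h)) (allFin g) + count (λ j → adj (G ⊕ H) (i ↑ˡ h) (g ↑ʳ j)) (allFin h)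
      ≡⟨ cong₂ _+_ (count-cong (allFin g) λ {j} _ → adj-⊕-↑ˡ-↑ˡ i j)
                   (trans (count-cong (allFin h) λ {j} _ → adj-⊕-↑ˡ-↑ʳ i j) (count-false (allFin h))) ⟩
    degree G i + 0
      ≡⟨ +-identityʳ _ ⟩
    degree G i ∎

  degree-⊕-↑ʳ : ∀ i → degree (G ⊕ H) (g ↑ʳ i) ≡ degree H i
  degree-⊕-↑ʳ i = begin
    degree (G ⊕ H) (g ↑ʳ i)
      ≡⟨ count-allFin-+ {g} {h} (adj (G ⊕ H) (g ↑ʳ i)) ⟩
    count (λ j → adj (G ⊕ H) (g ↑ʳ i) (j ↑ˡ h)) (allFin g) + count (λ j → adj (G ⊕ H) (g ↑ʳ i) (g ↑ʳ j)) (allFin h)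
      ≡⟨ cong₂ _+_ (trans (count-cong (allFin g) λ {j} _ → adj-⊕-↑ʳ-↑ˡ i j) (count-false (allFin g)))
                   (count-cong (allFin h) λ {j} _ → adj-⊕-↑ʳ-↑ʳ i j) ⟩
    degree H i ∎

  degrees-⊕ : degrees (G ⊕ H) ≡ degrees G ++ degrees H
  degrees-⊕ = begin
    map (degree (G ⊕ H)) (allFin (g + h))
      ≡⟨ map-allFin-+ {m = g} (degree (G ⊕ H)) ⟩
    tabulate (degree (G ⊕ H) ∘ (_↑ˡ h)) ++ tabulate (degree (G ⊕ H) ∘ (g ↑ʳ_))
      ≡⟨ cong₂ _++_ (tabulate-cong degree-⊕-↑ˡ) (tabulate-cong degree-⊕-↑ʳ) ⟩
    tabulate (degree G) ++ tabulate (degree H)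
      ≡⟨ cong₂ _++_ (map-tabulate id (degree G)) (map-tabulate id (degree H)) ⟨
    degrees G ++ degrees H ∎

degrees-disjointUnion : ∀ Hs → degrees (disjointUnion Hs) ≡ concatMap degrees Hs
degrees-disjointUnion []       = refl
degrees-disjointUnion (H ∷ Hs) = trans (degrees-⊕ H (disjointUnion Hs)) (cong (degrees H ++_) (degrees-disjointUnion Hs))

-- All bipartite graphs on at most N vertices, up to adjacency

booleans : List Bool
booleans = true ∷ false ∷ []

∈-booleans : ∀ b → b ∈ booleans
∈-booleans true  = here refl
∈-booleans false = there (here refl)

allFunctions : ∀ n → List A → List (Fin n → A)
allFunctions zero    xs = (λ ()) ∷ []
allFunctions (suc n) xs = concatMap (λ x → map (x ∷ᶠ_) (allFunctions n xs)) xs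

allFunctions-complete : ∀ {r} (R : A → A → Set r) xs n (f : Fin n → A) →
  (∀ i → ∃ λ x → x ∈ xs × R (f i) x) → ∃ λ g → g ∈ allFunctions n xs × ∀ i → R (f i) (g i)
allFunctions-complete R xs zero    f near = (λ ()) , here refl , λ ()
allFunctions-complete R xs (suc n) f near =
  let (x , x∈xs , Rx) = near Fin.zero
      (g , g∈ , Rg)   = allFunctions-complete R xs n (f ∘ Fin.suc) (near ∘ Fin.suc)
  in x ∷ᶠ g
   , ∈-concatMap⁺ (λ y → map (y ∷ᶠ_) (allFunctions n xs)) (lose x∈xs (∈-map⁺ (x ∷ᶠ_) g∈))
   , λ { Fin.zero → Rx ; (Fin.suc i) → Rg i }

-- Symmetrising the table and keeping only bichromatic pairs makes every table a bipartite graph.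
tableGraph : ∀ m → (Fin m → Fin m → Bool) → (Fin m → Bool) → Graph
tableGraph m E c = record
  { n        = m
  ; adj      = λ i j → (E i j ∧ E j i) ∧ (c i xor c j)
  ; sym      = λ i j → cong₂ _∧_ (∧-comm (E i j) (E j i)) (xor-comm (c i) (c j))
  ; loopless = λ i → trans (cong ((E i i ∧ E i i) ∧_) (xor-same (c i))) (∧-zeroʳ _)
  }

tableGraph-bipartite : ∀ m E c → Bipartite (tableGraph m E c)
tableGraph-bipartite m E c = c , λ i j adj≡true ci≡cj → contradiction
  (trans (sym adj≡true) (trans (cong (λ b → (E i j ∧ E j i) ∧ (b xor c j)) ci≡cj)
                               (trans (cong ((E i j ∧ E j i) ∧_) (xor-same (c j))) (∧-zeroʳ _))))
  λ ()

≢⇒xor : ∀ {x y : Bool} → x ≢ y → x xor y ≡ true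
≢⇒xor {true}  {true}  x≢y = contradiction refl x≢y
≢⇒xor {true}  {false} _   = refl
≢⇒xor {false} {true}  _   = refl
≢⇒xor {false} {false} x≢y = contradiction refl x≢y

tableGraph-adj : ∀ (H : Graph) (c : Fin (n H) → Bool) → (∀ i j → adj H i j ≡ true → c i ≢ c j) →
  ∀ i j → (adj H i j ∧ adj H j i) ∧ (c i xor c j) ≡ adj H i j
tableGraph-adj H c proper i j with adj H i j in eq
... | false = refl
... | true  rewrite trans (Graph.sym H j i) eq = ≢⇒xor (proper i j eq)

graphsOn : ℕ → List Graph
graphsOn m = concatMap (λ E → map (tableGraph m E) (allFunctions m booleans))
                       (allFunctions m (allFunctions m booleans))

bipartiteGraphsUpTo : ℕ → List Graph
bipartiteGraphsUpTo N = concatMap graphsOn (upTo (suc N))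

graphsOn-bipartite : ∀ m → All Bipartite (graphsOn m)
graphsOn-bipartite m = All.concat⁺ (All.map⁺ (All.universal
  (λ E → All.map⁺ (All.universal (tableGraph-bipartite m E) (allFunctions m booleans)))
  (allFunctions m (allFunctions m booleans))))

all-bipartite : ∀ N → All Bipartite (bipartiteGraphsUpTo N)
all-bipartite N = All.concat⁺ (All.map⁺ (All.universal graphsOn-bipartite (upTo (suc N))))

tableGraph-∈ : ∀ {N m E c} → m ≤ N → E ∈ allFunctions m (allFunctions m booleans) →
  c ∈ allFunctions m booleans → tableGraph m E c ∈ bipartiteGraphsUpTo N
tableGraph-∈ {m = m} {E} m≤N E∈ c∈ =
  ∈-concatMap⁺ graphsOn (lose (∈-upTo⁺ (s≤s m≤N))
    (∈-concatMap⁺ (λ E → map (tableGraph m E) (allFunctions m booleans)) (lose E∈ (∈-map⁺ (tableGraph m E) c∈))))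

representative : ∀ N (H : Graph) → Bipartite H → n H ≤ N →
  ∃ λ H′ → H′ ∈ bipartiteGraphsUpTo N × degrees H′ ≡ degrees H
representative N H (c , proper) n≤N =
  let (c′ , c′∈ , c≡c′) = allFunctions-complete _≡_ booleans m c (λ i → c i , ∈-booleans (c i) , refl)
      (E , E∈ , adj≡E)  = allFunctions-complete (λ f g → ∀ j → f j ≡ g j) (allFunctions m booleans)
                                                m (adj H) row

      same-adj : ∀ i j → adj (tableGraph m E c′) i j ≡ adj H i j
      same-adj i j = trans
        (sym (cong₂ _∧_ (cong₂ _∧_ (adj≡E i j) (adj≡E j i)) (cong₂ _xor_ (c≡c′ i) (c≡c′ j))))
        (tableGraph-adj H c proper i j)
  in tableGraph m E c′ , tableGraph-∈ n≤N E∈ c′∈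
   , map-cong (λ i → count-cong (allFin m) λ {j} _ → same-adj i j) (allFin m)
  where
  m = n H
  row : ∀ i → ∃ λ r → r ∈ allFunctions m booleans × ∀ j → adj H i j ≡ r j
  row i = allFunctions-complete _≡_ booleans m (adj H i) (λ j → adj H i j , ∈-booleans (adj H i j) , refl)

-- Induced subgraphs and the handshake lemma

induced : (G : Graph) → List (Fin (n G)) → Graph
induced G L = record
  { n        = length L
  ; adj      = λ i j → adj G (lookup L i) (lookup L j)
  ; sym      = λ i j → Graph.sym G (lookup L i) (lookup L j)
  ; loopless = loopless G ∘ lookup L
  }

induced-bipartite : ∀ G L → Bipartite G → Bipartite (induced G L)
induced-bipartite G L (c , proper) = c ∘ lookup L , λ i j → proper (lookup L i) (lookup L j)

degrees-induced : ∀ G L → degrees (induced G L) ≡ map (λ v → count (adj G v) L) L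
degrees-induced G L = begin
  map (degree (induced G L)) (allFin (length L))
    ≡⟨ map-cong (λ i → trans (sym (count-map (adj G (lookup L i)) (lookup L) (allFin (length L))))
                             (cong (count (adj G (lookup L i))) lookup-allFin)) (allFin (length L)) ⟩
  map ((λ v → count (adj G v) L) ∘ lookup L) (allFin (length L))
    ≡⟨ map-∘ (allFin (length L)) ⟩
  map (λ v → count (adj G v) L) (map (lookup L) (allFin (length L)))
    ≡⟨ cong (map (λ v → count (adj G v) L)) lookup-allFin ⟩
  map (λ v → count (adj G v) L) L ∎
  where
  open ≡-Reasoning
  lookup-allFin : map (lookup L) (allFin (length L)) ≡ L
  lookup-allFin = trans (map-tabulate id (lookup L)) (tabulate-lookup L)

≢⇒≡not : ∀ {x y : Bool} → x ≢ y → y ≡ not x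
≢⇒≡not {true}  {true}  x≢y = contradiction refl x≢y
≢⇒≡not {true}  {false} _   = refl
≢⇒≡not {false} {true}  _   = refl
≢⇒≡not {false} {false} x≢y = contradiction refl x≢y

module _ (G : Graph) (c : Fin (n G) → Bool) (proper : ∀ i j → adj G i j ≡ true → c i ≢ c j) where
  private
    V = allFin (n G)
  open ≡-Reasoning

  neighbour-colour : ∀ {i j} → T (adj G i j) → c j ≡ not (c i)
  neighbour-colour {i} {j} ij = ≢⇒≡not (proper i j (Equivalence.to T-≡ ij))

  degree-into-false : ∀ {i} → T (c i) → count (adj G i) (filterᵇ (not ∘ c) V) ≡ degree G i
  degree-into-false {i} ci = count-filter-redundant (adj G i) (not ∘ c) V
    λ ij → subst T (sym (trans (cong not (neighbour-colour ij)) (not-involutive (c i)))) ci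

  degree-into-true : ∀ {i} → T (not (c i)) → count (adj G i) (filterᵇ c V) ≡ degree G i
  degree-into-true {i} ¬ci = count-filter-redundant (adj G i) c V
    λ ij → subst T (sym (neighbour-colour ij)) ¬ci

  -- Both sides count the edges of G.
  handshake : sum (map (degree G) (filterᵇ c V)) ≡ sum (map (degree G) (filterᵇ (not ∘ c) V))
  handshake = begin
    sum (map (degree G) (filterᵇ c V))
      ≡⟨ cong sum (map-cong-local (All.map (sym ∘ degree-into-false) (all-filter (T? ∘ c) V))) ⟩
    sum (map (λ i → count (adj G i) (filterᵇ (not ∘ c) V)) (filterᵇ c V))
      ≡⟨ sum-count-swap (adj G) (filterᵇ c V) (filterᵇ (not ∘ c) V) ⟩
    sum (map (λ j → count (λ i → adj G i j) (filterᵇ c V)) (filterᵇ (not ∘ c) V))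
      ≡⟨ cong sum (map-cong (λ j → count-cong (filterᵇ c V) λ {i} _ → Graph.sym G i j) (filterᵇ (not ∘ c) V)) ⟩
    sum (map (λ j → count (adj G j) (filterᵇ c V)) (filterᵇ (not ∘ c) V))
      ≡⟨ cong sum (map-cong-local (All.map degree-into-true (all-filter (T? ∘ (not ∘ c)) V))) ⟩
    sum (map (degree G) (filterᵇ (not ∘ c) V)) ∎

-- Stubs

-- Vertex i of a degree list X owns the run of x_i consecutive "stubs" starting at x_0 + … + x_{i-1}.
owner : List ℕ → ℕ → ℕ
owner []      t = 0
owner (x ∷ X) t with t <? x
... | yes _ = 0
... | no  _ = suc (owner X (t ∸ x))

owner-< : ∀ X {t} → t < sum X → owner X t < length X
owner-< (x ∷ X) {t} t<sum with t <? x
... | yes _   = s≤s z≤n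
... | no  t≮x = s≤s (owner-< X (subst (t ∸ x <_) (m+n∸m≡n x (sum X)) (∸-monoˡ-< t<sum (≮⇒≥ t≮x))))

owner-below : ∀ {x} X {t} → t < x → owner (x ∷ X) t ≡ 0
owner-below {x} X {t} t<x with t <? x
... | yes _   = refl
... | no  t≮x = contradiction t<x t≮x

owner-shift : ∀ x X t → owner (x ∷ X) (x + t) ≡ suc (owner X t)
owner-shift x X t with x + t <? x
... | yes x+t<x = contradiction x+t<x (≤⇒≯ (m≤m+n x t))
... | no  _     = cong (suc ∘ owner X) (m+n∸m≡n x t)

count-owner : ∀ X (i : Fin (length X)) → count (λ t → owner X t ≡ᵇ toℕ i) (upTo (sum X)) ≡ lookup X i
count-owner (x ∷ X) i = begin
  count owns (upTo (x + sum X))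
    ≡⟨ cong (count owns) (upTo-+ x (sum X)) ⟩
  count owns (upTo x ++ map (x +_) (upTo (sum X)))
    ≡⟨ count-++ owns (upTo x) (map (x +_) (upTo (sum X))) ⟩
  count owns (upTo x) + count owns (map (x +_) (upTo (sum X)))
    ≡⟨ cong₂ _+_ (count-cong (upTo x) λ t∈ → cong (_≡ᵇ toℕ i) (owner-below X (∈-upTo⁻ t∈)))
                 (trans (count-map owns (x +_) (upTo (sum X)))
                        (count-cong (upTo (sum X)) λ {t} _ → cong (_≡ᵇ toℕ i) (owner-shift x X t))) ⟩
  count (λ _ → 0 ≡ᵇ toℕ i) (upTo x) + count (λ t → suc (owner X t) ≡ᵇ toℕ i) (upTo (sum X))
    ≡⟨ by-index i ⟩
  lookup (x ∷ X) i ∎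
  where
  open ≡-Reasoning
  owns : ℕ → Bool
  owns t = owner (x ∷ X) t ≡ᵇ toℕ i

  by-index : ∀ j → count (λ _ → 0 ≡ᵇ toℕ j) (upTo x) + count (λ t → suc (owner X t) ≡ᵇ toℕ j) (upTo (sum X))
                 ≡ lookup (x ∷ X) j
  by-index Fin.zero    = trans (cong₂ _+_ (trans (count-true (upTo x)) (length-upTo x)) (count-false (upTo (sum X))))
                               (+-identityʳ x)
  by-index (Fin.suc j) =
    trans (cong (_+ count (λ t → owner X t ≡ᵇ toℕ j) (upTo (sum X))) (count-false (upTo x))) (count-owner X j)

owner-close : ∀ {k} X {t t′} → All (_≤ k) X → t ≤ t′ → t′ < sum X → owner X t ≡ owner X t′ → t′ < t + k
owner-close {k} (x ∷ X) {t} {t′} (x≤k ∷ X≤k) t≤t′ t′<sum same with t <? x | t′ <? x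
... | yes _   | yes t′<x = ≤-trans t′<x (≤-trans x≤k (m≤n+m k t))
... | yes _   | no  _    = contradiction same 0≢1+n
... | no  t≮x | yes t′<x = contradiction (≤-<-trans t≤t′ t′<x) t≮x
... | no  t≮x | no  t′≮x = begin-strict
  t′                ≡⟨ m+[n∸m]≡n x≤t′ ⟨
  x + (t′ ∸ x)      <⟨ +-monoʳ-< x (owner-close X X≤k (∸-monoˡ-≤ x t≤t′) t′∸x<sum (suc-injective same)) ⟩
  x + (t ∸ x + k)   ≡⟨ +-assoc x (t ∸ x) k ⟨
  x + (t ∸ x) + k   ≡⟨ cong (_+ k) (m+[n∸m]≡n (≮⇒≥ t≮x)) ⟩
  t + k             ∎
  where
  open ≤-Reasoning
  x≤t′ = ≮⇒≥ t′≮x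
  t′∸x<sum : t′ ∸ x < sum X
  t′∸x<sum = subst (t′ ∸ x <_) (m+n∸m≡n x (sum X)) (∸-monoˡ-< t′<sum x≤t′)

-- Write t = u·s + r (s = k + 1) and lay the stubs 0 … m - 1 out row by row in a grid with s columns;
-- transpose t is the position of t when the grid is read column by column. Column r has
-- rows + 1 cells if r < extra and rows cells otherwise, so it starts at columnStart r.
module Transposition (k m : ℕ) (s²≤m : suc k * suc k ≤ m) where
  private
    s = suc k

  rows extra : ℕ
  rows  = m / s
  extra = m % s

  columnStart : ℕ → ℕ
  columnStart r = r * rows + r ⊓ extra

  transpose : ℕ → ℕ
  transpose t = columnStart (t % s) + t / s

  private
    divMod : ∀ t → t ≡ t % s + t / s * s
    divMod t = m≡m%n+[m/n]*n t s

    s≤rows : s ≤ rows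
    s≤rows = subst (_≤ m / s) (m*n/n≡m s s) (/-monoˡ-≤ s s²≤m)

    m≡ : s * rows + extra ≡ m
    m≡ = trans (+-comm (s * rows) extra) (trans (cong (extra +_) (*-comm s rows)) (sym (divMod m)))

    row-≤ : ∀ {r r′ u u′} → r′ < s → r + u * s < r′ + u′ * s → u ≤ u′
    row-≤ {r} {r′} {u} {u′} r′<s lt with u ≤? u′
    ... | yes u≤u′ = u≤u′
    ... | no  u≰u′ = contradiction lt (<-asym (begin-strict
      r′ + u′ * s <⟨ +-monoˡ-< (u′ * s) r′<s ⟩
      s + u′ * s  ≤⟨ *-monoˡ-≤ s (≰⇒> u≰u′) ⟩
      u * s       ≤⟨ m≤n+m (u * s) r ⟩
      r + u * s   ∎))
      where open ≤-Reasoning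

  columnStart-+rows : ∀ r → columnStart r + rows ≡ suc r * rows + r ⊓ extra
  columnStart-+rows r = begin
    r * rows + r ⊓ extra + rows   ≡⟨ +-assoc (r * rows) (r ⊓ extra) rows ⟩
    r * rows + (r ⊓ extra + rows) ≡⟨ cong (r * rows +_) (+-comm (r ⊓ extra) rows) ⟩
    r * rows + (rows + r ⊓ extra) ≡⟨ +-assoc (r * rows) rows (r ⊓ extra) ⟨
    r * rows + rows + r ⊓ extra   ≡⟨ cong (_+ r ⊓ extra) (+-comm (r * rows) rows) ⟩
    suc r * rows + r ⊓ extra      ∎
    where open ≡-Reasoning

  columnStart-gap : ∀ {r r′} → r < r′ → columnStart r + rows ≤ columnStart r′
  columnStart-gap {r} {r′} r<r′ = subst (_≤ columnStart r′) (sym (columnStart-+rows r))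
    (+-mono-≤ (*-monoˡ-≤ rows r<r′) (⊓-monoˡ-≤ extra (<⇒≤ r<r′)))

  columnStart-gap-long : ∀ {r r′} → r < r′ → r < extra → columnStart r + rows < columnStart r′
  columnStart-gap-long {r} {r′} r<r′ r<extra =
    subst (_< columnStart r′) (sym (trans (columnStart-+rows r) (cong (suc r * rows +_) (m≤n⇒m⊓n≡m (<⇒≤ r<extra)))))
      (+-mono-≤-< (*-monoˡ-≤ rows r<r′) (⊓-glb r<r′ r<extra))

  last-row : ∀ {t} → t < m → t / s < rows ⊎ (t / s ≡ rows × t % s < extra)
  last-row {t} t<m with <-cmp (t / s) rows
  ... | tri< u<rows _ _ = inj₁ u<rows
  ... | tri≈ _ u≡rows _ = inj₂ (u≡rows , +-cancelʳ-< (rows * s) (t % s) extra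
          (subst₂ _<_ (trans (divMod t) (cong (λ u → t % s + u * s) u≡rows)) (divMod m) t<m))
  ... | tri> _ _ u>rows = contradiction (/-monoˡ-≤ s (<⇒≤ t<m)) (<⇒≱ u>rows)

  transpose-< : ∀ {t} → t < m → transpose t < m
  transpose-< {t} t<m with last-row t<m
  ... | inj₁ u<rows = begin-strict
    columnStart (t % s) + t / s        <⟨ +-monoʳ-< (columnStart (t % s)) u<rows ⟩
    columnStart (t % s) + rows         ≡⟨ columnStart-+rows (t % s) ⟩
    suc (t % s) * rows + t % s ⊓ extra ≤⟨ +-mono-≤ (*-monoˡ-≤ rows (m%n<n t s)) (m⊓n≤n (t % s) extra) ⟩
    s * rows + extra                   ≡⟨ m≡ ⟩
    m                                  ∎
    where open ≤-Reasoning
  ... | inj₂ (u≡rows , r<extra) = begin-strict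
    columnStart (t % s) + t / s        ≡⟨ cong (columnStart (t % s) +_) u≡rows ⟩
    columnStart (t % s) + rows         ≡⟨ columnStart-+rows (t % s) ⟩
    suc (t % s) * rows + t % s ⊓ extra ≡⟨ cong (suc (t % s) * rows +_) (m≤n⇒m⊓n≡m (<⇒≤ r<extra)) ⟩
    suc (t % s) * rows + t % s         <⟨ +-monoʳ-< (suc (t % s) * rows) r<extra ⟩
    suc (t % s) * rows + extra         ≤⟨ +-monoˡ-≤ extra (*-monoˡ-≤ rows (m%n<n t s)) ⟩
    s * rows + extra                   ≡⟨ m≡ ⟩
    m                                  ∎
    where open ≤-Reasoning

  transpose-column-< : ∀ {t} t′ → t < m → t % s < t′ % s → transpose t < transpose t′
  transpose-column-< {t} t′ t<m r<r′ with last-row t<m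
  ... | inj₁ u<rows = begin-strict
    columnStart (t % s) + t / s  <⟨ +-monoʳ-< (columnStart (t % s)) u<rows ⟩
    columnStart (t % s) + rows   ≤⟨ columnStart-gap r<r′ ⟩
    columnStart (t′ % s)         ≤⟨ m≤m+n (columnStart (t′ % s)) (t′ / s) ⟩
    transpose t′                 ∎
    where open ≤-Reasoning
  ... | inj₂ (u≡rows , r<extra) = begin-strict
    columnStart (t % s) + t / s  ≡⟨ cong (columnStart (t % s) +_) u≡rows ⟩
    columnStart (t % s) + rows   <⟨ columnStart-gap-long r<r′ r<extra ⟩
    columnStart (t′ % s)         ≤⟨ m≤m+n (columnStart (t′ % s)) (t′ / s) ⟩
    transpose t′                 ∎
    where open ≤-Reasoning

  transpose-injective : ∀ {t t′} → t < m → t′ < m → transpose t ≡ transpose t′ → t ≡ t′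
  transpose-injective {t} {t′} t<m t′<m eq with <-cmp (t % s) (t′ % s)
  ... | tri< r<r′ _ _ = contradiction eq (<⇒≢ (transpose-column-< t′ t<m r<r′))
  ... | tri> _ _ r>r′ = contradiction (sym eq) (<⇒≢ (transpose-column-< t t′<m r>r′))
  ... | tri≈ _ r≡r′ _ = trans (divMod t) (trans (cong₂ (λ r u → r + u * s) r≡r′ u≡u′) (sym (divMod t′)))
    where
    u≡u′ : t / s ≡ t′ / s
    u≡u′ = +-cancelˡ-≡ (columnStart (t % s)) (t / s) (t′ / s)
             (trans eq (cong (λ r → columnStart r + t′ / s) (sym r≡r′)))

  same-or-next-row : ∀ {t t′} → t < t′ → t′ < t + s →
    (t / s ≡ t′ / s × t % s < t′ % s) ⊎ (t′ / s ≡ suc (t / s) × t′ % s < t % s)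
  same-or-next-row {t} {t′} t<t′ t′<t+s = by-row (m≤n⇒m<n∨m≡n (row-≤ (m%n<n t′ s) t<t′ᵈ))
    where
    t<t′ᵈ : t % s + t / s * s < t′ % s + t′ / s * s
    t<t′ᵈ = subst₂ _<_ (divMod t) (divMod t′) t<t′

    t+s≡ : t + s ≡ t % s + suc (t / s) * s
    t+s≡ = trans (cong (_+ s) (divMod t))
                 (trans (+-assoc (t % s) (t / s * s) s) (cong (t % s +_) (+-comm (t / s * s) s)))

    t′<nextᵈ : t′ % s + t′ / s * s < t % s + suc (t / s) * s
    t′<nextᵈ = subst₂ _<_ (divMod t′) t+s≡ t′<t+s

    by-row : t / s < t′ / s ⊎ t / s ≡ t′ / s →
      (t / s ≡ t′ / s × t % s < t′ % s) ⊎ (t′ / s ≡ suc (t / s) × t′ % s < t % s)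
    by-row (inj₂ u≡u′) = inj₁ (u≡u′ , +-cancelʳ-< (t / s * s) (t % s) (t′ % s)
      (subst (λ v → t % s + t / s * s < t′ % s + v * s) (sym u≡u′) t<t′ᵈ))
    by-row (inj₁ u<u′) = inj₂ (u′≡1+u , +-cancelʳ-< (suc (t / s) * s) (t′ % s) (t % s)
      (subst (λ v → t′ % s + v * s < t % s + suc (t / s) * s) u′≡1+u t′<nextᵈ))
      where
      u′≡1+u = ≤-antisym (row-≤ (m%n<n t s) t′<nextᵈ) u<u′

  -- Stubs fewer than k apart are sent at least k apart: distinct columns start at least rows ≥ k + 1 apart.
  transpose-spreads : ∀ {t t′} → t < t′ → t′ < t + k →
                      transpose t′ < transpose t + k → transpose t < transpose t′ + k → ⊥
  transpose-spreads {t} {t′} t<t′ t′<t+k near₁ near₂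
    with same-or-next-row t<t′ (<-≤-trans t′<t+k (+-monoʳ-≤ t (n≤1+n k)))
  ... | inj₁ (u≡u′ , r<r′) = <-asym near₁ (begin-strict
    columnStart (t % s) + t / s + k       <⟨ +-monoʳ-< _ (<-≤-trans (n<1+n k) s≤rows) ⟩
    columnStart (t % s) + t / s + rows    ≡⟨ +-assoc (columnStart (t % s)) (t / s) rows ⟩
    columnStart (t % s) + (t / s + rows)  ≡⟨ cong (columnStart (t % s) +_) (+-comm (t / s) rows) ⟩
    columnStart (t % s) + (rows + t / s)  ≡⟨ +-assoc (columnStart (t % s)) rows (t / s) ⟨
    columnStart (t % s) + rows + t / s    ≤⟨ +-monoˡ-≤ (t / s) (columnStart-gap r<r′) ⟩
    columnStart (t′ % s) + t / s          ≡⟨ cong (columnStart (t′ % s) +_) u≡u′ ⟩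
    transpose t′                          ∎)
    where open ≤-Reasoning
  ... | inj₂ (u′≡1+u , r′<r) = <-irrefl refl (<-≤-trans near₂ (begin
    columnStart (t′ % s) + t′ / s + k       ≡⟨ cong (λ v → columnStart (t′ % s) + v + k) u′≡1+u ⟩
    columnStart (t′ % s) + suc (t / s) + k  ≡⟨ +-assoc (columnStart (t′ % s)) (suc (t / s)) k ⟩
    columnStart (t′ % s) + (suc (t / s) + k) ≡⟨ cong (columnStart (t′ % s) +_) (+-suc (t / s) k) ⟨
    columnStart (t′ % s) + (t / s + s)      ≤⟨ +-monoʳ-≤ (columnStart (t′ % s)) (+-monoʳ-≤ (t / s) s≤rows) ⟩
    columnStart (t′ % s) + (t / s + rows)   ≡⟨ cong (columnStart (t′ % s) +_) (+-comm (t / s) rows) ⟩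
    columnStart (t′ % s) + (rows + t / s)   ≡⟨ +-assoc (columnStart (t′ % s)) rows (t / s) ⟨
    columnStart (t′ % s) + rows + t / s     ≤⟨ +-monoˡ-≤ (t / s) (columnStart-gap r′<r) ⟩
    transpose t                             ∎))
    where open ≤-Reasoning

-- Realising a block

module TwoSided (p q : ℕ) (E : ℕ → ℕ → Bool) where

  adjacent : Fin (p + q) → Fin (p + q) → Bool
  adjacent i j with splitAt p i | splitAt p j
  ... | inj₁ a | inj₂ b = E (toℕ a) (toℕ b)
  ... | inj₂ b | inj₁ a = E (toℕ a) (toℕ b)
  ... | inj₁ _ | inj₁ _ = false
  ... | inj₂ _ | inj₂ _ = false

  adjacent-sym : ∀ i j → adjacent i j ≡ adjacent j i
  adjacent-sym i j with splitAt p i | splitAt p j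
  ... | inj₁ _ | inj₂ _ = refl
  ... | inj₂ _ | inj₁ _ = refl
  ... | inj₁ _ | inj₁ _ = refl
  ... | inj₂ _ | inj₂ _ = refl

  adjacent-irrefl : ∀ i → adjacent i i ≡ false
  adjacent-irrefl i with splitAt p i
  ... | inj₁ _ = refl
  ... | inj₂ _ = refl

  graph : Graph
  graph = record { n = p + q ; adj = adjacent ; sym = adjacent-sym ; loopless = adjacent-irrefl }

  side : Fin (p + q) → Bool
  side i with splitAt p i
  ... | inj₁ _ = true
  ... | inj₂ _ = false

  bipartite : Bipartite graph
  bipartite = side , proper
    where
    proper : ∀ i j → adjacent i j ≡ true → side i ≢ side j
    proper i j ij with splitAt p i | splitAt p j
    proper i j () | inj₁ _ | inj₁ _
    proper i j () | inj₂ _ | inj₂ _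
    ... | inj₁ _ | inj₂ _ = λ ()
    ... | inj₂ _ | inj₁ _ = λ ()

  count-allFin-toℕ : ∀ m (f : ℕ → Bool) → count (f ∘ toℕ) (allFin m) ≡ count f (upTo m)
  count-allFin-toℕ m f = trans (sym (count-tabulate {n = m} f toℕ)) (cong (count f) (tabulate-toℕ m id))

  degree-left : ∀ a → degree graph (a ↑ˡ q) ≡ count (E (toℕ a)) (upTo q)
  degree-left a = begin
    degree graph (a ↑ˡ q)
      ≡⟨ count-allFin-+ {p} {q} (adjacent (a ↑ˡ q)) ⟩
    count (λ a′ → adjacent (a ↑ˡ q) (a′ ↑ˡ q)) (allFin p) + count (λ b → adjacent (a ↑ˡ q) (p ↑ʳ b)) (allFin q)
      ≡⟨ cong₂ _+_ (trans (count-cong (allFin p) λ {a′} _ → within a a′) (count-false (allFin p)))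
                   (trans (count-cong (allFin q) λ {b} _ → across a b) (count-allFin-toℕ q (E (toℕ a)))) ⟩
    count (E (toℕ a)) (upTo q) ∎
    where
    open ≡-Reasoning
    within : ∀ a a′ → adjacent (a ↑ˡ q) (a′ ↑ˡ q) ≡ false
    within a a′ rewrite splitAt-↑ˡ p a q | splitAt-↑ˡ p a′ q = refl
    across : ∀ a b → adjacent (a ↑ˡ q) (p ↑ʳ b) ≡ E (toℕ a) (toℕ b)
    across a b rewrite splitAt-↑ˡ p a q | splitAt-↑ʳ p q b = refl

  degree-right : ∀ b → degree graph (p ↑ʳ b) ≡ count (λ a → E a (toℕ b)) (upTo p)
  degree-right b = begin
    degree graph (p ↑ʳ b)
      ≡⟨ count-allFin-+ {p} {q} (adjacent (p ↑ʳ b)) ⟩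
    count (λ a → adjacent (p ↑ʳ b) (a ↑ˡ q)) (allFin p) + count (λ b′ → adjacent (p ↑ʳ b) (p ↑ʳ b′)) (allFin q)
      ≡⟨ cong₂ _+_ (trans (count-cong (allFin p) λ {a} _ → across b a) (count-allFin-toℕ p (λ a → E a (toℕ b))))
                   (trans (count-cong (allFin q) λ {b′} _ → within b b′) (count-false (allFin q))) ⟩
    count (λ a → E a (toℕ b)) (upTo p) + 0
      ≡⟨ +-identityʳ _ ⟩
    count (λ a → E a (toℕ b)) (upTo p) ∎
    where
    open ≡-Reasoning
    within : ∀ b b′ → adjacent (p ↑ʳ b) (p ↑ʳ b′) ≡ false
    within b b′ rewrite splitAt-↑ʳ p q b | splitAt-↑ʳ p q b′ = refl
    across : ∀ b a → adjacent (p ↑ʳ b) (a ↑ˡ q) ≡ E (toℕ a) (toℕ b)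
    across b a rewrite splitAt-↑ʳ p q b | splitAt-↑ˡ p a q = refl

  degrees-graph : degrees graph ≡ tabulate {n = p} (λ a → count (E (toℕ a)) (upTo q))
                               ++ tabulate {n = q} (λ b → count (λ a → E a (toℕ b)) (upTo p))
  degrees-graph = trans (map-allFin-+ {m = p} {n = q} (degree graph))
                        (cong₂ _++_ (tabulate-cong {n = p} degree-left) (tabulate-cong {n = q} degree-right))

module Linking (S : List ℕ) (f g : ℕ → ℕ) where

  linked : ℕ → ℕ → Bool
  linked a b = any (λ t → (f t ≡ᵇ a) ∧ (g t ≡ᵇ b)) S

  linked⁻ : ∀ {a b} → T (linked a b) → ∃ λ t → t ∈ S × f t ≡ a × g t ≡ b
  linked⁻ {a} {b} ab =
    let (t , t∈S , link) = find (any⁻ (λ t → (f t ≡ᵇ a) ∧ (g t ≡ᵇ b)) S ab)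
        (fa , gb) = Equivalence.to T-∧ link
    in t , t∈S , ≡ᵇ⇒≡ (f t) a fa , ≡ᵇ⇒≡ (g t) b gb

  linked⁺ : ∀ {t} → t ∈ S → T (linked (f t) (g t))
  linked⁺ {t} t∈S = any⁺ _ (lose t∈S (Equivalence.from T-∧ (≡⇒≡ᵇ (f t) (f t) refl , ≡⇒≡ᵇ (g t) (g t) refl)))

  -- If a stub is determined by its two ends, g maps the stubs at a bijectively onto the partners of a.
  count-linked : ∀ {q} → Unique S → (∀ {t u} → t ∈ S → u ∈ S → f t ≡ f u → g t ≡ g u → t ≡ u) →
    (∀ {t} → t ∈ S → g t < q) → ∀ a → count (linked a) (upTo q) ≡ count (λ t → f t ≡ᵇ a) S
  count-linked {q} S! determined g<q a = begin
    length (filterᵇ (linked a) (upTo q))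
      ≡⟨ unique-⇔-length (Unique.filter⁺ (T? ∘ linked a) {upTo q} (upTo⁺ q))
                         (unique-map-on g (Unique.filter⁺ (T? ∘ at-a) S!) determined-at-a) (mk⇔ to from) ⟩
    length (map g (filterᵇ at-a S))
      ≡⟨ length-map g (filterᵇ at-a S) ⟩
    count at-a S ∎
    where
    open ≡-Reasoning
    at-a : ℕ → Bool
    at-a t = f t ≡ᵇ a

    stub-at-a : ∀ {t} → t ∈ filterᵇ at-a S → t ∈ S × f t ≡ a
    stub-at-a t∈ = let (t∈S , ft≡a) = ∈-filter⁻ (T? ∘ at-a) {xs = S} t∈ in t∈S , ≡ᵇ⇒≡ _ a ft≡a

    determined-at-a : ∀ {t u} → t ∈ filterᵇ at-a S → u ∈ filterᵇ at-a S → g t ≡ g u → t ≡ u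
    determined-at-a t∈ u∈ = let (t∈S , ft≡a) = stub-at-a t∈ ; (u∈S , fu≡a) = stub-at-a u∈ in
      determined t∈S u∈S (trans ft≡a (sym fu≡a))

    to : ∀ {b} → b ∈ filterᵇ (linked a) (upTo q) → b ∈ map g (filterᵇ at-a S)
    to b∈ = let (t , t∈S , ft≡a , gt≡b) = linked⁻ (proj₂ (∈-filter⁻ (T? ∘ linked a) {xs = upTo q} b∈)) in
      subst (_∈ map g (filterᵇ at-a S)) gt≡b (∈-map⁺ g (∈-filter⁺ (T? ∘ at-a) t∈S (≡⇒≡ᵇ _ a ft≡a)))

    from : ∀ {b} → b ∈ map g (filterᵇ at-a S) → b ∈ filterᵇ (linked a) (upTo q)
    from b∈ = let (t , t∈ , b≡gt) = ∈-map⁻ g b∈ ; (t∈S , ft≡a) = stub-at-a t∈ in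
      subst (_∈ filterᵇ (linked a) (upTo q)) (sym b≡gt)
        (∈-filter⁺ (T? ∘ linked a) (∈-upTo⁺ (g<q t∈S)) (subst (λ c → T (linked c (g t))) ft≡a (linked⁺ t∈S)))

linked-swap : ∀ S f g a b → Linking.linked S f g a b ≡ Linking.linked S g f b a
linked-swap S f g a b = cong or (map-cong (λ t → ∧-comm (f t ≡ᵇ a) (g t ≡ᵇ b)) S)

-- Two degree lists to be realised as the two sides of one bipartite graph.
record Block (k : ℕ) : Set where
  constructor block
  field
    left right : List ℕ
    left≤k     : All (_≤ k) left
    right≤k    : All (_≤ k) right
    balanced   : sum left ≡ sum right
    large      : suc k * suc k ≤ sum left

  size : ℕ
  size = length left + length right

  entries : List ℕ
  entries = left ++ right

-- Left stub t is joined to right stub transpose t.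
module Realization {k} (b : Block k) where
  open Block b
  private
    m = sum left
    p = length left
    q = length right
  open Transposition k m large

  rightOwner : ℕ → ℕ
  rightOwner t = owner right (transpose t)

  private
    transpose<sum : ∀ {t} → t < m → transpose t < sum right
    transpose<sum {t} t<m = subst (transpose t <_) balanced (transpose-< t<m)

    right-close : ∀ {t t′} → t′ < m → transpose t ≤ transpose t′ → rightOwner t ≡ rightOwner t′ →
                  transpose t′ < transpose t + k
    right-close {t} {t′} t′<m ≤′ same = owner-close right right≤k ≤′ (transpose<sum {t′} t′<m) same

    stubs-apart : ∀ {t t′} → t < t′ → t′ < m → owner left t ≡ owner left t′ → rightOwner t ≢ rightOwner t′
    stubs-apart {t} {t′} t<t′ t′<m same-left = apart (≤-total (transpose t) (transpose t′))
      where
      t′<t+k : t′ < t + k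
      t′<t+k = owner-close left left≤k (<⇒≤ t<t′) t′<m same-left

      0<k : 0 < k
      0<k = +-cancelˡ-< t 0 k (subst (_< t + k) (sym (+-identityʳ t)) (<-trans t<t′ t′<t+k))

      apart : transpose t ≤ transpose t′ ⊎ transpose t′ ≤ transpose t → rightOwner t ≢ rightOwner t′
      apart (inj₁ ≤′) same-right = transpose-spreads {t} {t′} t<t′ t′<t+k
        (right-close {t} t′<m ≤′ same-right) (≤-<-trans ≤′ (m<m+n _ 0<k))
      apart (inj₂ ≥′) same-right = transpose-spreads {t} {t′} t<t′ t′<t+k
        (≤-<-trans ≥′ (m<m+n _ 0<k)) (right-close {t′} (<-trans t<t′ t′<m) ≥′ (sym same-right))

  stub-determined : ∀ {t t′} → t ∈ upTo m → t′ ∈ upTo m →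
                    owner left t ≡ owner left t′ → rightOwner t ≡ rightOwner t′ → t ≡ t′
  stub-determined {t} {t′} t∈ t′∈ same-left same-right with <-cmp t t′
  ... | tri≈ _ t≡t′ _ = t≡t′
  ... | tri< t<t′ _ _ = contradiction same-right (stubs-apart t<t′ (∈-upTo⁻ t′∈) same-left)
  ... | tri> _ _ t>t′ = contradiction (sym same-right) (stubs-apart t>t′ (∈-upTo⁻ t∈) (sym same-left))

  open Linking (upTo m) (owner left) rightOwner
  open TwoSided p q linked using (degrees-graph)
  open TwoSided p q linked public using () renaming (graph to realization; bipartite to realization-bipartite)

  left-degree : ∀ (i : Fin p) → count (linked (toℕ i)) (upTo q) ≡ lookup left i
  left-degree i = trans
    (count-linked (upTo⁺ m) stub-determined
                  (λ {t} t∈ → owner-< right (transpose<sum {t} (∈-upTo⁻ t∈))) (toℕ i))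
    (count-owner left i)

  right-degree : ∀ (j : Fin q) → count (λ a → linked a (toℕ j)) (upTo p) ≡ lookup right j
  right-degree j = begin
    count (λ a → linked a (toℕ j)) (upTo p)
      ≡⟨ count-cong (upTo p) (λ {a} _ → linked-swap (upTo m) (owner left) rightOwner a (toℕ j)) ⟩
    count (Linking.linked (upTo m) rightOwner (owner left) (toℕ j)) (upTo p)
      ≡⟨ Linking.count-linked (upTo m) rightOwner (owner left) (upTo⁺ m)
           (λ t∈ t′∈ same-right same-left → stub-determined t∈ t′∈ same-left same-right)
           (λ t∈ → owner-< left (∈-upTo⁻ t∈)) (toℕ j) ⟩
    count (λ t → owner right (transpose t) ≡ᵇ toℕ j) (upTo m)
      ≡⟨ count-∘-upTo transpose-< transpose-injective (λ u → owner right u ≡ᵇ toℕ j) ⟩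
    count (λ u → owner right u ≡ᵇ toℕ j) (upTo m)
      ≡⟨ cong (λ M → count (λ u → owner right u ≡ᵇ toℕ j) (upTo M)) balanced ⟩
    count (λ u → owner right u ≡ᵇ toℕ j) (upTo (sum right))
      ≡⟨ count-owner right j ⟩
    lookup right j ∎
    where open ≡-Reasoning

  degrees-realization : degrees realization ≡ entries
  degrees-realization = trans degrees-graph (cong₂ _++_
    (trans (tabulate-cong left-degree) (tabulate-lookup left))
    (trans (tabulate-cong right-degree) (tabulate-lookup right)))

-- Cutting two degree lists into blocks

length≤sum : ∀ {xs} → All (1 ≤_) xs → length xs ≤ sum xs
length≤sum []           = z≤n
length≤sum (1≤x ∷ 1≤xs) = +-mono-≤ 1≤x (length≤sum 1≤xs)

sum≤length* : ∀ {k xs} → All (_≤ k) xs → sum xs ≤ length xs * k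
sum≤length* []           = z≤n
sum≤length* (x≤k ∷ xs≤k) = +-mono-≤ x≤k (sum≤length* xs≤k)

sum-replicate : ∀ r x → sum (replicate r x) ≡ r * x
sum-replicate zero    x = refl
sum-replicate (suc r) x = cong (x +_) (sum-replicate r x)

length≤sum-counts : ∀ ds xs → All (_∈ ds) xs → length xs ≤ sum (map (λ d → count (_≡ᵇ d) xs) ds)
length≤sum-counts ds xs xs⊆ds = begin
  length xs                                 ≡⟨ length-map (λ x → count (x ≡ᵇ_) ds) xs ⟨
  length (map (λ x → count (x ≡ᵇ_) ds) xs)  ≤⟨ length≤sum (All.map⁺ (All.map occurs xs⊆ds)) ⟩
  sum (map (λ x → count (x ≡ᵇ_) ds) xs)     ≡⟨ sum-count-swap _≡ᵇ_ xs ds ⟩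
  sum (map (λ d → count (_≡ᵇ d) xs) ds)     ∎
  where
  open ≤-Reasoning
  occurs : ∀ {x} → x ∈ ds → 1 ≤ count (x ≡ᵇ_) ds
  occurs {x} x∈ds = filter-some (T? ∘ (x ≡ᵇ_)) (Any.map (≡⇒≡ᵇ x _) x∈ds)

pigeonhole : ∀ c ds xs → All (_∈ ds) xs → length ds * c < length xs → ∃ λ d → d ∈ ds × c ≤ count (_≡ᵇ d) xs
pigeonhole c ds xs xs⊆ds long with any? (λ d → c ≤? count (_≡ᵇ d) xs) ds
... | yes some = find some
... | no  none = contradiction long (≤⇒≯ (begin
  length xs                              ≤⟨ length≤sum-counts ds xs xs⊆ds ⟩
  sum (map (λ d → count (_≡ᵇ d) xs) ds)
    ≤⟨ sum≤length* (All.map⁺ (All.map (<⇒≤ ∘ ≰⇒>) (¬Any⇒All¬ ds none))) ⟩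
  length (map (λ d → count (_≡ᵇ d) xs) ds) * c ≡⟨ cong (_* c) (length-map _ ds) ⟩
  length ds * c                          ∎))
  where open ≤-Reasoning

extract : ∀ d r xs → r ≤ count (_≡ᵇ d) xs → ∃ λ xs′ → xs ↭ replicate r d ++ xs′
extract d zero    xs       _      = xs , ↭-refl
extract d (suc r) (x ∷ xs) enough with x ≡ᵇ d in x≡ᵇd
... | true  = let (xs′ , xs↭) = extract d r xs (s≤s⁻¹ enough) in
  xs′ , subst (λ y → x ∷ xs ↭ y ∷ replicate r d ++ xs′) (≡ᵇ⇒≡ x d (subst T (sym x≡ᵇd) tt)) (prep x xs↭)
... | false = let (xs′ , xs↭) = extract d (suc r) xs enough in
  x ∷ xs′ , ↭-trans (prep x xs↭) (↭-sym (shift x (replicate (suc r) d) xs′))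

replicate-balanced : ∀ m d e → sum (replicate (e * m) d) ≡ sum (replicate (d * m) e)
replicate-balanced m d e = begin
  sum (replicate (e * m) d) ≡⟨ sum-replicate (e * m) d ⟩
  e * m * d                 ≡⟨ *-comm (e * m) d ⟩
  d * (e * m)               ≡⟨ cong (d *_) (*-comm e m) ⟩
  d * (m * e)               ≡⟨ *-assoc d m e ⟨
  d * m * e                 ≡⟨ sum-replicate (d * m) e ⟨
  sum (replicate (d * m) e) ∎
  where open ≡-Reasoning

replicate-large : ∀ {m d e} → 1 ≤ d → 1 ≤ e → m ≤ sum (replicate (e * m) d)
replicate-large {m} {d} {e} 1≤d 1≤e = begin
  m                         ≤⟨ m≤n*m m e {{>-nonZero 1≤e}} ⟩
  e * m                     ≤⟨ m≤m*n (e * m) d {{>-nonZero 1≤d}} ⟩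
  e * m * d                 ≡⟨ sum-replicate (e * m) d ⟨
  sum (replicate (e * m) d) ∎
  where open ≤-Reasoning

InRange : ℕ → ℕ → Set
InRange k d = 1 ≤ d × d ≤ k

module BlockDecomposition (k : ℕ) where

  -- m₀ is the least block sum, c₀ bounds the copies a cut takes from one list, and a list of length
  -- at least threshold has c₀ equal entries (pigeonhole) and keeps length at least m₀ after a cut.
  m₀ c₀ threshold blockBound : ℕ
  m₀         = suc k * suc k
  c₀         = k * m₀
  threshold  = k * c₀ + (c₀ + m₀)
  blockBound = (threshold + threshold * k) + (c₀ + c₀)

  Decomposition : List ℕ → Set
  Decomposition ds = Σ (List (Block k)) λ bs →
    All (λ b → Block.size b ≤ blockBound) bs × concatMap Block.entries bs ↭ ds

  private
    values : List ℕ
    values = applyUpTo suc k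

    ∈-values : ∀ {d} → InRange k d → d ∈ values
    ∈-values {suc i} (_ , i<k) = ∈-applyUpTo⁺ suc i<k

    values-range : ∀ {d} → d ∈ values → InRange k d
    values-range d∈ with ∈-applyUpTo⁻ suc d∈
    ... | i , i<k , refl = s≤s z≤n , i<k

    k*c₀<threshold : k * c₀ < threshold
    k*c₀<threshold = m<m+n (k * c₀) (<-≤-trans (s≤s z≤n) (m≤n+m m₀ c₀))

    frequent : ∀ {zs} → All (InRange k) zs → threshold ≤ length zs →
               ∃ λ d → InRange k d × c₀ ≤ count (_≡ᵇ d) zs
    frequent {zs} zs-ok long =
      let (d , d∈ , many) = pigeonhole c₀ values zs (All.map ∈-values zs-ok) (<-≤-trans k*c₀<length long)
      in d , values-range d∈ , many
      where
      k*c₀<length : length values * c₀ < threshold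
      k*c₀<length = subst (λ l → l * c₀ < threshold) (sym (length-applyUpTo suc k)) k*c₀<threshold

  peel : ∀ xs ys → All (InRange k) xs → All (InRange k) ys → threshold ≤ length xs → threshold ≤ length ys →
    Σ (Block k) λ b → Σ (List ℕ) λ xs′ → Σ (List ℕ) λ ys′ →
      length (Block.left b) ≤ c₀ × length (Block.right b) ≤ c₀ ×
      xs ↭ Block.left b ++ xs′ × ys ↭ Block.right b ++ ys′
  peel xs ys xs-ok ys-ok long-xs long-ys =
    let (d , (1≤d , d≤k) , many-d) = frequent xs-ok long-xs
        (e , (1≤e , e≤k) , many-e) = frequent ys-ok long-ys
        (xs′ , xs↭) = extract d (e * m₀) xs (≤-trans (*-monoˡ-≤ m₀ e≤k) many-d)
        (ys′ , ys↭) = extract e (d * m₀) ys (≤-trans (*-monoˡ-≤ m₀ d≤k) many-e)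
    in block (replicate (e * m₀) d) (replicate (d * m₀) e)
             (All.replicate⁺ (e * m₀) d≤k) (All.replicate⁺ (d * m₀) e≤k)
             (replicate-balanced m₀ d e) (replicate-large 1≤d 1≤e)
     , xs′ , ys′
     , ≤-trans (≤-reflexive (length-replicate (e * m₀))) (*-monoˡ-≤ m₀ e≤k)
     , ≤-trans (≤-reflexive (length-replicate (d * m₀))) (*-monoˡ-≤ m₀ d≤k)
     , xs↭ , ys↭

  private
    length-short : ∀ {xs ys} → All (InRange k) xs → All (InRange k) ys → sum xs ≡ sum ys →
                   length xs < threshold → length xs + length ys ≤ threshold + threshold * k
    length-short {xs} {ys} xs-ok ys-ok balanced short = +-mono-≤ (<⇒≤ short) (begin
      length ys     ≤⟨ length≤sum (All.map proj₁ ys-ok) ⟩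
      sum ys        ≡⟨ balanced ⟨
      sum xs        ≤⟨ sum≤length* (All.map proj₂ xs-ok) ⟩
      length xs * k ≤⟨ *-monoˡ-≤ k (<⇒≤ short) ⟩
      threshold * k ∎)
      where open ≤-Reasoning

    whole : ∀ {xs ys} → All (InRange k) xs → All (InRange k) ys → sum xs ≡ sum ys → m₀ ≤ sum xs →
            length xs + length ys ≤ threshold + threshold * k → Decomposition (xs ++ ys)
    whole {xs} {ys} xs-ok ys-ok balanced large small =
      block xs ys (All.map proj₂ xs-ok) (All.map proj₂ ys-ok) balanced large ∷ []
      , ≤-trans small (m≤m+n _ (c₀ + c₀)) ∷ []
      , ↭-reflexive (++-identityʳ (xs ++ ys))

    leftover : ∀ {a b} → threshold ≤ a + b → a ≤ c₀ → m₀ ≤ b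
    leftover {a} {b} ≤a+b a≤c₀ = +-cancelˡ-≤ c₀ m₀ b (begin
      c₀ + m₀    ≤⟨ m≤n+m (c₀ + m₀) (k * c₀) ⟩
      threshold  ≤⟨ ≤a+b ⟩
      a + b      ≤⟨ +-monoˡ-≤ b a≤c₀ ⟩
      c₀ + b     ∎)
      where open ≤-Reasoning

  -- Peeling keeps both lists long enough that the final remainder still has sum at least m₀.
  decompose : ∀ xs ys → All (InRange k) xs → All (InRange k) ys → sum xs ≡ sum ys → m₀ ≤ sum xs →
              Acc _<_ (sum xs) → Decomposition (xs ++ ys)
  decompose xs ys xs-ok ys-ok balanced large (acc smaller) with threshold ≤? length xs | threshold ≤? length ys
  ... | no xs-short | _ = whole xs-ok ys-ok balanced large (length-short xs-ok ys-ok balanced (≰⇒> xs-short))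
  ... | yes _ | no ys-short = whole xs-ok ys-ok balanced large
        (subst (_≤ threshold + threshold * k) (+-comm (length ys) (length xs))
               (length-short ys-ok xs-ok (sym balanced) (≰⇒> ys-short)))
  ... | yes long-xs | yes long-ys =
    let (b , xs′ , ys′ , left≤ , right≤ , xs↭ , ys↭) = peel xs ys xs-ok ys-ok long-xs long-ys
        open Block b using (left; right)
        xs′-ok = All.++⁻ʳ left (All-resp-↭ xs↭ xs-ok)
        ys′-ok = All.++⁻ʳ right (All-resp-↭ ys↭ ys-ok)
        sum-xs = trans (sum-↭ xs↭) (sum-++ left xs′)
        sum-ys = trans (sum-↭ ys↭) (sum-++ right ys′)
        balanced′ = +-cancelˡ-≡ (sum left) (sum xs′) (sum ys′)
          (trans (sym sum-xs) (trans balanced (trans sum-ys (cong (_+ sum ys′) (sym (Block.balanced b))))))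
        long-xs′ = leftover (subst (threshold ≤_) (trans (↭-length xs↭) (length-++ left)) long-xs) left≤
        large′ = ≤-trans long-xs′ (length≤sum (All.map proj₁ xs′-ok))
        shorter = <-≤-trans (m<n+m (sum xs′) (<-≤-trans (s≤s z≤n) (Block.large b))) (≤-reflexive (sym sum-xs))
        (bs , bs-small , bs↭) = decompose xs′ ys′ xs′-ok ys′-ok balanced′ large′ (smaller shorter)
    in b ∷ bs
     , ≤-trans (+-mono-≤ left≤ right≤) (m≤n+m (c₀ + c₀) (threshold + threshold * k)) ∷ bs-small
     , ↭-trans (++⁺ˡ (left ++ right) bs↭)
         (↭-trans (++-interchange left right xs′ ys′) (↭-sym (++⁺ xs↭ ys↭)))

  decomposition : ∀ xs ys → All (InRange k) xs → All (InRange k) ys → sum xs ≡ sum ys → m₀ ≤ sum xs →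
                  Decomposition (xs ++ ys)
  decomposition xs ys xs-ok ys-ok balanced large =
    decompose xs ys xs-ok ys-ok balanced large (<-wellFounded (sum xs))

-- Realisability of degree lists

filter-positive-≥1 : ∀ ds → All (1 ≤_) (filterᵇ (0 <ᵇ_) ds)
filter-positive-≥1 ds = All.map (λ {d} → <ᵇ⇒< 0 d) (all-filter (T? ∘ (0 <ᵇ_)) ds)

sum-filter-positive : ∀ ds → sum (filterᵇ (0 <ᵇ_) ds) ≡ sum ds
sum-filter-positive []           = refl
sum-filter-positive (zero  ∷ ds) = sum-filter-positive ds
sum-filter-positive (suc d ∷ ds) = cong (suc d +_) (sum-filter-positive ds)

nonisolated : (G : Graph) → List (Fin (n G))
nonisolated G = filterᵇ (λ v → 0 <ᵇ degree G v) (allFin (n G))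

-- Neighbours are never isolated, so deleting the isolated vertices changes no other degree.
degrees-nonisolated : ∀ G → degrees (induced G (nonisolated G)) ≡ filterᵇ (0 <ᵇ_) (degrees G)
degrees-nonisolated G = begin
  degrees (induced G (nonisolated G))
    ≡⟨ degrees-induced G (nonisolated G) ⟩
  map (λ v → count (adj G v) (nonisolated G)) (nonisolated G)
    ≡⟨ map-cong (λ v → count-filter-redundant (adj G v) (λ j → 0 <ᵇ degree G j) (allFin (n G)) neighbour-nonisolated)
                (nonisolated G) ⟩
  map (degree G) (nonisolated G)
    ≡⟨ map-filterᵇ (0 <ᵇ_) (degree G) (allFin (n G)) ⟩
  filterᵇ (0 <ᵇ_) (degrees G) ∎
  where
  open ≡-Reasoning
  neighbour-nonisolated : ∀ {v j} → T (adj G v j) → T (0 <ᵇ degree G j)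
  neighbour-nonisolated {v} {j} vj =
    <⇒<ᵇ (filter-some (T? ∘ adj G j) (lose (∈-allFin v) (subst T (Graph.sym G v j) vj)))

isolatedVertex : Graph
isolatedVertex = tableGraph 1 (λ _ _ → false) (λ _ → false)

module RealizableBy (N : ℕ) where

  Realizable : List ℕ → Set
  Realizable ds = Σ (List Graph) λ Hs → All (_∈ bipartiteGraphsUpTo N) Hs × concatMap degrees Hs ↭ ds

  realizable-↭ : ∀ {ds es} → ds ↭ es → Realizable ds → Realizable es
  realizable-↭ ds↭es (Hs , Hs∈ , Hs↭ds) = Hs , Hs∈ , ↭-trans Hs↭ds ds↭es

  realizable-++ : ∀ {ds es} → Realizable ds → Realizable es → Realizable (ds ++ es)
  realizable-++ (Hs , Hs∈ , Hs↭ds) (Ks , Ks∈ , Ks↭es) =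
    Hs ++ Ks , All.++⁺ Hs∈ Ks∈ , subst (_↭ _) (sym (concatMap-++ degrees Hs Ks)) (++⁺ Hs↭ds Ks↭es)

  realizable-graph : ∀ H → Bipartite H → n H ≤ N → Realizable (degrees H)
  realizable-graph H bipartite n≤N =
    let (H′ , H′∈ , degrees≡) = representative N H bipartite n≤N
    in H′ ∷ [] , H′∈ ∷ [] , ↭-reflexive (trans (++-identityʳ (degrees H′)) degrees≡)

  realizable-zeros : ∀ {zs} → 1 ≤ N → All (_≡ 0) zs → Realizable zs
  realizable-zeros 1≤N []          = [] , [] , ↭-refl
  realizable-zeros 1≤N (refl ∷ zs) = realizable-++
    (realizable-graph isolatedVertex (tableGraph-bipartite 1 (λ _ _ → false) (λ _ → false)) 1≤N)
    (realizable-zeros 1≤N zs)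

  realizable-blocks : ∀ {k} {bs : List (Block k)} → All (λ b → Block.size b ≤ N) bs →
                      Realizable (concatMap Block.entries bs)
  realizable-blocks []                          = [] , [] , ↭-refl
  realizable-blocks {bs = b ∷ _} (b≤N ∷ bs≤N) = realizable-++
    (subst Realizable degrees-realization (realizable-graph realization realization-bipartite b≤N))
    (realizable-blocks bs≤N)
    where open Realization b

module Realizability (k : ℕ) where
  open BlockDecomposition k

  bound : ℕ
  bound = blockBound + (m₀ + m₀)

  open RealizableBy bound

  module _ (G : Graph) (c : Fin (n G) → Bool) (proper : ∀ i j → adj G i j ≡ true → c i ≢ c j)
           (max≤k : MaxDegree≤ G k) where
    private
      V = allFin (n G)
      positive = 0 <ᵇ_
      side : (Fin (n G) → Bool) → List ℕ
      side p = filterᵇ positive (map (degree G) (filterᵇ p V))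

      side-ok : ∀ p → All (InRange k) (side p)
      side-ok p = All.zip ( filter-positive-≥1 (map (degree G) (filterᵇ p V))
                          , All.filter⁺ (T? ∘ positive) (All.map⁺ (All.universal max≤k (filterᵇ p V))))

    positive-degrees↭sides : filterᵇ positive (degrees G) ↭ side c ++ side (not ∘ c)
    positive-degrees↭sides =
      subst (filterᵇ positive (degrees G) ↭_) (filter-++ (T? ∘ positive) (map (degree G) (filterᵇ c V)) _)
        (filter-↭ (T? ∘ positive)
          (subst (degrees G ↭_) (map-++ (degree G) (filterᵇ c V) _) (map⁺ (degree G) (filter-partition-↭ c V))))

    sides-balanced : sum (side c) ≡ sum (side (not ∘ c))
    sides-balanced = trans (sum-filter-positive (map (degree G) (filterᵇ c V)))
      (trans (handshake G c proper) (sym (sum-filter-positive (map (degree G) (filterᵇ (not ∘ c) V)))))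

    realizable-positive : Realizable (filterᵇ positive (degrees G))
    realizable-positive with m₀ ≤? sum (side c)
    ... | yes large =
      let (bs , bs-small , bs↭) = decomposition (side c) (side (not ∘ c)) (side-ok c) (side-ok (not ∘ c))
                                    sides-balanced large
      in realizable-↭ (↭-trans bs↭ (↭-sym positive-degrees↭sides))
           (realizable-blocks (All.map (λ b≤ → ≤-trans b≤ (m≤m+n blockBound (m₀ + m₀))) bs-small))
    ... | no  small =
      subst Realizable (degrees-nonisolated G)
        (realizable-graph (induced G (nonisolated G)) (induced-bipartite G (nonisolated G) (c , proper)) few)
      where
      open ≤-Reasoning
      sum≤m₀ : sum (side c) ≤ m₀
      sum≤m₀ = <⇒≤ (≰⇒> small)

      few : length (nonisolated G) ≤ bound
      few = begin
        length (nonisolated G)                  ≡⟨ length-map (degree G) (nonisolated G) ⟨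
        length (map (degree G) (nonisolated G)) ≡⟨ cong length (map-filterᵇ positive (degree G) V) ⟩
        length (filterᵇ positive (degrees G))   ≤⟨ length≤sum (filter-positive-≥1 (degrees G)) ⟩
        sum (filterᵇ positive (degrees G))      ≡⟨ sum-↭ positive-degrees↭sides ⟩
        sum (side c ++ side (not ∘ c))          ≡⟨ sum-++ (side c) (side (not ∘ c)) ⟩
        sum (side c) + sum (side (not ∘ c))     ≤⟨ +-mono-≤ sum≤m₀ (subst (_≤ m₀) sides-balanced sum≤m₀) ⟩
        m₀ + m₀                                 ≤⟨ m≤n+m (m₀ + m₀) blockBound ⟩
        bound                                   ∎

  degrees-realizable : ∀ G → Bipartite G → MaxDegree≤ G k → Realizable (degrees G)
  degrees-realizable G (c , proper) max≤k = realizable-↭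
    (↭-sym (filter-partition-↭ (0 <ᵇ_) (degrees G)))
    (realizable-++ (realizable-positive G c proper max≤k)
                   (realizable-zeros (≤-trans (s≤s z≤n) (m≤n+m (m₀ + m₀) blockBound))
                      (All.map (λ {d} → nonpositive d) (all-filter (T? ∘ (not ∘ (0 <ᵇ_))) (degrees G)))))
    where
    nonpositive : ∀ d → T (not (0 <ᵇ d)) → d ≡ 0
    nonpositive zero _ = refl

corollary1 : (k : ℕ) → Σ (List Graph) λ Z →
    All Bipartite Z ×
    ((G : Graph) → Bipartite G → MaxDegree≤ G k →
      Σ (List Graph) λ Hs →
        All (λ H → H ∈ Z) Hs × (degreeSequence (disjointUnion Hs) ≡ degreeSequence G))
corollary1 k = bipartiteGraphsUpTo bound , all-bipartite bound , λ G bipartite max≤k →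
  let (Hs , Hs∈Z , Hs↭G) = degrees-realizable G bipartite max≤k
  in Hs , Hs∈Z , trans (cong sort (degrees-disjointUnion Hs)) (sort-cong Hs↭G)
  where open Realizability k
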